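{- Let $x,n$ be integers with $x,n\geq 2$ and $x>n$, and let $H$ be a connected $k$-regular graph on $m\geq 2$ vertices with $k\geq 1$. Then the edge corona $B_{x,n}\diamond H$ is antimagic.
   Context: All graphs are simple, finite and undirected. For a graph $G$ with $q$ edges, an antimagic labeling is a bijection $f:E(G)\to\{1,2,\dots,q\}$ such that the vertex sums $w(u)=\sum_{e\ni u} f(e)$ (sum over the edges incident to $u$) are pairwise distinct over all vertices $u\in V(G)$. A graph is antimagic if it admits an antimagic labeling. The bistar graph $B_{x,n}$ is obtained from two vertex-disjoint stars $K_{1,x}$ and $K_{1,n}$ by adding an edge between their centers. For graphs $G$ and $H$, the edge corona $G\diamond H$ is obtained by taking one copy of $G$ and $|E(G)|$ vertex-disjoint copies of $H$, one copy associated to each edge of $G$, and joining both end vertices of the $i$-th edge of $G$ to every vertex of the $i$-th copy of $H$. -}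

module Defs where

open import Data.Nat using (ℕ; zero; suc; _+_; _*_)
open import Data.Fin using (Fin; zero; suc; toℕ; _≟_; _↑ˡ_; _↑ʳ_; splitAt; combine; remQuot)
open import Data.Sum using (_⊎_; inj₁; inj₂)
open import Data.Product using (_×_; _,_; proj₁; proj₂; ∃)
open import Data.Bool using (Bool; true; false; _∨_; if_then_else_)
open import Data.List using (List; map; allFin)
open import Data.Nat.ListAction using (sum)
open import Relation.Nullary using (does; ¬_)
open import Relation.Binary.PropositionalEquality using (_≡_; _≢_)
open import Relation.Binary.Construct.Closure.ReflexiveTransitive using (Star)
open import Function.Bundles using (_⤖_; Bijection)
open import Function.Definitions using (Injective)

-- A (multi)graph given by an edge list: vertices Fin V, edges Fin E,
-- each edge has an (ordered, but read as unordered) pair of end vertices.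
record Graph : Set where
  field
    V    : ℕ
    E    : ℕ
    ends : Fin E → Fin V × Fin V
open Graph public

record IsSimple (G : Graph) : Set where
  field
    noLoop  : ∀ e → proj₁ (ends G e) ≢ proj₂ (ends G e)
    noMulti : ∀ e e' → (ends G e ≡ ends G e' ⊎
                        (proj₁ (ends G e) ≡ proj₂ (ends G e') × proj₂ (ends G e) ≡ proj₁ (ends G e')))
                     → e ≡ e'

incident : (G : Graph) → Fin (V G) → Fin (E G) → Bool
incident G u e = does (u ≟ proj₁ (ends G e)) ∨ does (u ≟ proj₂ (ends G e))

incSum : (G : Graph) → (Fin (E G) → ℕ) → Fin (V G) → ℕ
incSum G g u = sum (map (λ e → if incident G u e then g e else 0) (allFin (E G)))

degree : (G : Graph) → Fin (V G) → ℕ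
degree G = incSum G (λ _ → 1)

IsRegular : ℕ → Graph → Set
IsRegular k G = ∀ u → degree G u ≡ k

Adj : (G : Graph) → Fin (V G) → Fin (V G) → Set
Adj G u v = ∃ λ e → ends G e ≡ (u , v) ⊎ ends G e ≡ (v , u)

IsConnected : Graph → Set
IsConnected G = ∀ u v → Star (Adj G) u v

-- A labeling is a bijection Fin q → Fin q; edge e gets label 1 + toℕ (f e) ∈ {1..q}.
IsAntimagicLabeling : (G : Graph) → Fin (E G) ⤖ Fin (E G) → Set
IsAntimagicLabeling G f =
  Injective _≡_ _≡_ (incSum G (λ e → suc (toℕ (Bijection.to f e))))

IsAntimagic : Graph → Set
IsAntimagic G = ∃ λ f → IsAntimagicLabeling G f

-- Bistar B_{x,n}: vertex 0 = centre of K_{1,x}, vertex 1 = centre of K_{1,n},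
-- vertices 2..x+1 leaves of the first star, x+2..x+n+1 leaves of the second.
-- Edge 0 joins the centres.
bistar : ℕ → ℕ → Graph
bistar x n = record { V = 2 + (x + n) ; E = suc (x + n) ; ends = en }
  where
  en : Fin (suc (x + n)) → Fin (2 + (x + n)) × Fin (2 + (x + n))
  en zero = zero , suc zero
  en (suc j) with splitAt x j
  ... | inj₁ a = zero , suc (suc (a ↑ˡ n))
  ... | inj₂ b = suc zero , suc (suc (x ↑ʳ b))

-- Vertices: V G original ones, then for each edge i of G a copy of H (index combine i a).
-- Edges: E G original ones, then for each edge i of G: the E H edges of its copy of H,
-- then V H edges from the first end of i to the copy, then V H edges from the second end.
edgeCorona : Graph → Graph → Graph
edgeCorona G H = record
  { V = V G + E G * V H
  ; E = E G + E G * (E H + (V H + V H))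
  ; ends = en }
  where
  old : Fin (V G) → Fin (V G + E G * V H)
  old v = v ↑ˡ (E G * V H)
  new : Fin (E G) → Fin (V H) → Fin (V G + E G * V H)
  new i a = V G ↑ʳ combine i a
  en : Fin (E G + E G * (E H + (V H + V H))) → Fin (V G + E G * V H) × Fin (V G + E G * V H)
  en e with splitAt (E G) e
  ... | inj₁ i = old (proj₁ (ends G i)) , old (proj₂ (ends G i))
  ... | inj₂ t with remQuot (E H + (V H + V H)) t
  ... | i , r with splitAt (E H) r
  ... | inj₁ h = new i (proj₁ (ends H h)) , new i (proj₂ (ends H h))
  ... | inj₂ s with splitAt (V H) s
  ... | inj₁ a = old (proj₁ (ends G i)) , new i a
  ... | inj₂ a = old (proj₂ (ends G i)) , new i a

-- Order the edges of B_{x,n} by a position: the n leaf edges of the smaller star first, then the x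
-- leaf edges of the larger star, then the edge joining the centres.  Label B_{x,n} ⋄ H in three layers:
-- the copies of H get the smallest labels, copy by copy in order of position; next the spokes (the edges
-- joining a copy to the two ends of its base edge), in blocks of m = |V H| labels; the edges of B_{x,n}
-- get the largest labels.  Inside a spoke block the vertices of H are ordered by rank with respect to
-- τ b = ∑_{h ∋ b} (1 + h), so within a copy the vertex weights increase with that rank, and between
-- copies with the position.  As H is simple, k < m; hence every copy vertex (degree k + 2, small labels)
-- is lighter than every vertex of B_{x,n}, each of which sees a base edge and a whole spoke block.  A leaf
-- weighs more the later its edge comes, but less than the centre of the smaller star, and the centre of
-- the larger star is the heaviest vertex: it has more, and later, leaves, and the top spoke block lies on
-- its side of the centre edge.

module Submission where

open import Data.Bool using (Bool; true; false; _∨_; _∧_; if_then_else_)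
open import Data.Bool.Properties using (∧-distribˡ-∨; ∨-identityʳ)
open import Data.Empty using (⊥-elim)
open import Data.Fin
  using (Fin; zero; suc; toℕ; _≟_; _↑ˡ_; _↑ʳ_; splitAt; join; combine; punchOut; remQuot; quotRem; inject≤; fromℕ<)
open import Data.Fin.Properties
  using ( toℕ<n; toℕ-injective; suc-injective; toℕ-inject≤; toℕ-fromℕ<; toℕ-↑ˡ; toℕ-↑ʳ; ↑ˡ-injective; ↑ʳ-injective
        ; splitAt-↑ˡ; splitAt-↑ʳ; splitAt⁻¹-↑ˡ; splitAt⁻¹-↑ʳ; join-splitAt
        ; combine-injective; remQuot-combine; combine-remQuot; any?; punchOut-injective; injective⇒≤ )
open import Data.List using (map; allFin; tabulate)
open import Data.List.Properties using (map-tabulate; map-cong)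
open import Data.Nat using (ℕ; zero; suc; _+_; _*_; _≤_; _<_; _<?_; z≤n; s≤s; s≤s⁻¹)
open import Data.Nat.ListAction using (sum)
open import Data.Nat.Properties hiding (_≟_; suc-injective)
open import Algebra.Properties.CommutativeMonoid.Sum +-0-commutativeMonoid
  using (sum-syntax; sum-cong-≗)
open import Algebra.Properties.CommutativeSemigroup +-commutativeSemigroup
  using (interchange)
open import Data.Product using (_×_; _,_; proj₁; proj₂; ∃; uncurry)
import Data.Product as Product
open import Data.Sum using (_⊎_; inj₁; inj₂; [_,_]′)
open import Data.Nat.Solver using (module +-*-Solver)
open +-*-Solver using (solve; _:+_; _:*_; _:=_; con)
open import Function using (id; _∘_)
open import Function.Definitions using (Injective; Surjective)
open import Function.Bundles using (_⤖_; mk⤖; Bijection)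
open import Relation.Binary.Definitions using (tri<; tri≈; tri>)
open import Relation.Binary.PropositionalEquality
open import Relation.Nullary using (does; yes; no)
open import Relation.Nullary.Decidable using (dec-true; dec-false)

open import Defs

-- Finite sums

select : Bool → ℕ → ℕ
select b v = if b then v else 0

select-+ : ∀ b u v → select b (u + v) ≡ select b u + select b v
select-+ true  u v = refl
select-+ false u v = refl

select-∧ : ∀ b c v → select (b ∧ c) v ≡ select b (select c v)
select-∧ true  c v = refl
select-∧ false c v = refl

select-≤ : ∀ b {u v} → u ≤ v → select b u ≤ select b v
select-≤ true  u≤v = u≤v
select-≤ false u≤v = z≤n

select-*-1 : ∀ b v → select b v ≡ v * select b 1
select-*-1 true  v = sym (*-identityʳ v)
select-*-1 false v = sym (*-zeroʳ v)

∑-mono-≤ : ∀ n {f g : Fin n → ℕ} → (∀ i → f i ≤ g i) → ∑[ i < n ] f i ≤ ∑[ i < n ] g i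
∑-mono-≤ zero    f≤g = z≤n
∑-mono-≤ (suc n) f≤g = +-mono-≤ (f≤g zero) (∑-mono-≤ n (f≤g ∘ suc))

∑-mono-< : ∀ n {f g : Fin n → ℕ} → (∀ i → f i ≤ g i) → ∀ c → f c < g c →
           ∑[ i < n ] f i < ∑[ i < n ] g i
∑-mono-< (suc n) f≤g zero    fc<gc = +-mono-<-≤ fc<gc (∑-mono-≤ n (f≤g ∘ suc))
∑-mono-< (suc n) f≤g (suc c) fc<gc = +-mono-≤-< (f≤g zero) (∑-mono-< n (f≤g ∘ suc) c fc<gc)

∑-const : ∀ n c → ∑[ i < n ] c ≡ n * c
∑-const zero    c = refl
∑-const (suc n) c = cong (c +_) (∑-const n c)

∑-zero : ∀ n → ∑[ i < n ] 0 ≡ 0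
∑-zero n = trans (∑-const n 0) (*-zeroʳ n)

∑-distrib-+ : ∀ n (f g : Fin n → ℕ) → ∑[ i < n ] (f i + g i) ≡ ∑[ i < n ] f i + ∑[ i < n ] g i
∑-distrib-+ zero    f g = refl
∑-distrib-+ (suc n) f g = begin
  (f zero + g zero) + ∑[ i < n ] (f (suc i) + g (suc i))
    ≡⟨ cong ((f zero + g zero) +_) (∑-distrib-+ n (f ∘ suc) (g ∘ suc)) ⟩
  (f zero + g zero) + (∑[ i < n ] f (suc i) + ∑[ i < n ] g (suc i))
    ≡⟨ interchange (f zero) (g zero) _ _ ⟩
  (f zero + ∑[ i < n ] f (suc i)) + (g zero + ∑[ i < n ] g (suc i)) ∎
  where open ≡-Reasoning

∑-*-distribˡ : ∀ n c (f : Fin n → ℕ) → ∑[ i < n ] (c * f i) ≡ c * ∑[ i < n ] f i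
∑-*-distribˡ zero    c f = sym (*-zeroʳ c)
∑-*-distribˡ (suc n) c f =
  trans (cong (c * f zero +_) (∑-*-distribˡ n c (f ∘ suc))) (sym (*-distribˡ-+ c (f zero) _))

∑-select : ∀ n b (f : Fin n → ℕ) → ∑[ i < n ] select b (f i) ≡ select b (∑[ i < n ] f i)
∑-select n true  f = refl
∑-select n false f = ∑-zero n

∑-↑ : ∀ m n (f : Fin (m + n) → ℕ) →
      ∑[ i < m + n ] f i ≡ ∑[ i < m ] f (i ↑ˡ n) + ∑[ j < n ] f (m ↑ʳ j)
∑-↑ zero    n f = refl
∑-↑ (suc m) n f = trans (cong (f zero +_) (∑-↑ m n (f ∘ suc))) (sym (+-assoc (f zero) _ _))

∑-combine : ∀ m n (f : Fin (m * n) → ℕ) →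
            ∑[ k < m * n ] f k ≡ ∑[ i < m ] ∑[ j < n ] f (combine i j)
∑-combine zero    n f = refl
∑-combine (suc m) n f =
  trans (∑-↑ n (m * n) f) (cong (∑[ j < n ] f (j ↑ˡ (m * n)) +_) (∑-combine m n (f ∘ (n ↑ʳ_))))

∑-comm : ∀ m n (f : Fin m → Fin n → ℕ) →
         ∑[ i < m ] ∑[ j < n ] f i j ≡ ∑[ j < n ] ∑[ i < m ] f i j
∑-comm zero    n f = sym (∑-zero n)
∑-comm (suc m) n f = trans (cong (∑[ j < n ] f zero j +_) (∑-comm m n (f ∘ suc)))
                           (sym (∑-distrib-+ n (f zero) (λ j → ∑[ i < m ] f (suc i) j)))

∑-inject≤ : ∀ {m n} (m≤n : m ≤ n) (f : Fin m → ℕ) (g : Fin n → ℕ) →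
            (∀ i → f i ≤ g (inject≤ i m≤n)) → ∑[ i < m ] f i ≤ ∑[ j < n ] g j
∑-inject≤ {zero}  {n}     m≤n f g f≤g = z≤n
∑-inject≤ {suc m} {suc n} m≤n f g f≤g =
  +-mono-≤ (f≤g zero) (∑-inject≤ (s≤s⁻¹ m≤n) (f ∘ suc) (g ∘ suc) (f≤g ∘ suc))

∑-tabulate : ∀ n (f : Fin n → ℕ) → sum (map f (allFin n)) ≡ ∑[ i < n ] f i
∑-tabulate n f = trans (cong sum (map-tabulate id f)) (go n f)
  where
  go : ∀ n (f : Fin n → ℕ) → sum (tabulate f) ≡ ∑[ i < n ] f i
  go zero    f = refl
  go (suc n) f = cong (f zero +_) (go n (f ∘ suc))

_==_ : ∀ {n} → Fin n → Fin n → Bool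
i == j = does (i ≟ j)

==-refl : ∀ {n} (i : Fin n) → (i == i) ≡ true
==-refl i = dec-true (i ≟ i) refl

==-≢ : ∀ {n} {i j : Fin n} → i ≢ j → (i == j) ≡ false
==-≢ {i = i} {j} i≢j = dec-false (i ≟ j) i≢j

==⇒≡ : ∀ {n} {i j : Fin n} → (i == j) ≡ true → i ≡ j
==⇒≡ {i = i} {j} eq with i ≟ j
... | yes i≡j = i≡j

==-injective : ∀ {m n} {f : Fin m → Fin n} → Injective _≡_ _≡_ f → ∀ i j → (f i == f j) ≡ (i == j)
==-injective {f = f} f-inj i j with i ≟ j
... | yes refl = ==-refl (f i)
... | no  i≢j  = ==-≢ (i≢j ∘ f-inj)

∑-point : ∀ n (c : Fin n) (f : Fin n → ℕ) → ∑[ i < n ] select (c == i) (f i) ≡ f c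
∑-point (suc n) zero    f = trans (cong (f zero +_) (∑-zero n)) (+-identityʳ (f zero))
∑-point (suc n) (suc c) f = ∑-point n c (f ∘ suc)

∑-select-unique : ∀ n (b : Fin n → Bool) → (∀ i j → b i ≡ true → b j ≡ true → i ≡ j) →
                  ∑[ i < n ] select (b i) 1 ≤ 1
∑-select-unique zero    b unique = z≤n
∑-select-unique (suc n) b unique with b zero in b₀
... | false = ∑-select-unique n (b ∘ suc) (λ i j bi bj → suc-injective (unique (suc i) (suc j) bi bj))
... | true  = ≤-reflexive (cong suc (trans (sum-cong-≗ none) (∑-zero n)))
  where
  none : ∀ i → select (b (suc i)) 1 ≡ 0
  none i with b (suc i) in bᵢ
  ... | false = refl
  ... | true  with () ← unique zero (suc i) b₀ bᵢ

∑-select-∧ : ∀ n c (b : Fin n → Bool) (f : Fin n → ℕ) →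
             ∑[ k < n ] select (c ∧ b k) (f k) ≡ select c (∑[ k < n ] select (b k) (f k))
∑-select-∧ n c b f = trans (sum-cong-≗ (λ k → select-∧ c (b k) (f k))) (∑-select n c _)

-- Incidence sums

incSum-∑ : ∀ G g u → incSum G g u ≡ ∑[ e < E G ] select (incident G u e) (g e)
incSum-∑ G g u = ∑-tabulate (E G) _

incSum-cong : ∀ G {g g′ : Fin (E G) → ℕ} → (∀ e → g e ≡ g′ e) → ∀ u → incSum G g u ≡ incSum G g′ u
incSum-cong G g≗g′ u = cong sum (map-cong (λ e → cong (select (incident G u e)) (g≗g′ e)) (allFin (E G)))

incSum-+-const : ∀ G c (g : Fin (E G) → ℕ) u →
                 incSum G (λ e → c + g e) u ≡ c * degree G u + incSum G g u
incSum-+-const G c g u = begin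
  incSum G (λ e → c + g e) u
    ≡⟨ incSum-∑ G _ u ⟩
  ∑[ e < E G ] select (incident G u e) (c + g e)
    ≡⟨ sum-cong-≗ (λ e → select-+ (incident G u e) c (g e)) ⟩
  ∑[ e < E G ] (select (incident G u e) c + select (incident G u e) (g e))
    ≡⟨ ∑-distrib-+ (E G) _ _ ⟩
  ∑[ e < E G ] select (incident G u e) c + ∑[ e < E G ] select (incident G u e) (g e)
    ≡⟨ cong₂ _+_ scale (sym (incSum-∑ G g u)) ⟩
  c * degree G u + incSum G g u ∎
  where
  open ≡-Reasoning
  scale : ∑[ e < E G ] select (incident G u e) c ≡ c * degree G u
  scale = trans (sum-cong-≗ (λ e → select-*-1 (incident G u e) c))
                (trans (∑-*-distribˡ (E G) c _) (cong (c *_) (sym (incSum-∑ G _ u))))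

incSum-≤ : ∀ G (g : Fin (E G) → ℕ) {B} → (∀ e → g e ≤ B) → ∀ u → incSum G g u ≤ B * degree G u
incSum-≤ G g {B} g≤B u = begin
  incSum G g u                                  ≡⟨ incSum-∑ G g u ⟩
  ∑[ e < E G ] select (incident G u e) (g e)    ≤⟨ ∑-mono-≤ (E G) (λ e → select-≤ (incident G u e) (g≤B e)) ⟩
  ∑[ e < E G ] select (incident G u e) B        ≡⟨ sum-cong-≗ (λ e → select-*-1 (incident G u e) B) ⟩
  ∑[ e < E G ] (B * select (incident G u e) 1)  ≡⟨ ∑-*-distribˡ (E G) B _ ⟩
  B * ∑[ e < E G ] select (incident G u e) 1    ≡⟨ cong (B *_) (sym (incSum-∑ G _ u)) ⟩
  B * degree G u                                ∎
  where open ≤-Reasoning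

endSum : (G : Graph) (B A₁ A₂ : Fin (E G) → ℕ) → Fin (V G) → ℕ
endSum G B A₁ A₂ v = ∑[ i < E G ] (select (incident G v i) (B i)
                                   + (select (v == proj₁ (ends G i)) (A₁ i) + select (v == proj₂ (ends G i)) (A₂ i)))

endSum-cong : ∀ G {B B′ A₁ A₁′ A₂ A₂′ : Fin (E G) → ℕ} →
              (∀ i → B i ≡ B′ i) → (∀ i → A₁ i ≡ A₁′ i) → (∀ i → A₂ i ≡ A₂′ i) →
              ∀ v → endSum G B A₁ A₂ v ≡ endSum G B′ A₁′ A₂′ v
endSum-cong G B≗B′ A₁≗A₁′ A₂≗A₂′ v = sum-cong-≗ λ i →
  cong₂ _+_ (cong (select (incident G v i)) (B≗B′ i))
            (cong₂ _+_ (cong (select (v == proj₁ (ends G i))) (A₁≗A₁′ i))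
                       (cong (select (v == proj₂ (ends G i))) (A₂≗A₂′ i)))

module _ {G : Graph} (simple : IsSimple G) (a : Fin (V G)) where
  open IsSimple simple

  private
    other : Fin (E G) → Fin (V G)
    other h = if a == proj₁ (ends G h) then proj₂ (ends G h) else proj₁ (ends G h)

    joins : Fin (V G) → Fin (E G) → Bool
    joins v h = incident G a h ∧ (other h == v)

    joins-ends : ∀ v h → joins v h ≡ true → ends G h ≡ (a , v) ⊎ ends G h ≡ (v , a)
    joins-ends v h eq with a ≟ proj₁ (ends G h) | a ≟ proj₂ (ends G h)
    ... | yes a≡₁ | _       = inj₁ (cong₂ _,_ (sym a≡₁) (==⇒≡ eq))
    ... | no  _   | yes a≡₂ = inj₂ (cong₂ _,_ (==⇒≡ eq) (sym a≡₂))

    reversed : ∀ {h h′ u w} → ends G h ≡ (u , w) → ends G h′ ≡ (w , u) →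
               proj₁ (ends G h) ≡ proj₂ (ends G h′) × proj₂ (ends G h) ≡ proj₁ (ends G h′)
    reversed e e′ = trans (cong proj₁ e) (sym (cong proj₂ e′)) , trans (cong proj₂ e) (sym (cong proj₁ e′))

    joins-unique : ∀ v h h′ → joins v h ≡ true → joins v h′ ≡ true → h ≡ h′
    joins-unique v h h′ eq eq′ with joins-ends v h eq | joins-ends v h′ eq′
    ... | inj₁ e | inj₁ e′ = noMulti h h′ (inj₁ (trans e (sym e′)))
    ... | inj₁ e | inj₂ e′ = noMulti h h′ (inj₂ (reversed e e′))
    ... | inj₂ e | inj₁ e′ = noMulti h h′ (inj₂ (reversed e e′))
    ... | inj₂ e | inj₂ e′ = noMulti h h′ (inj₁ (trans e (sym e′)))

    joins-self : ∀ h → joins a h ≡ false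
    joins-self h with a ≟ proj₁ (ends G h) | a ≟ proj₂ (ends G h)
    ... | yes a≡₁ | _       = ==-≢ (λ ₂≡a → noLoop h (trans (sym a≡₁) (sym ₂≡a)))
    ... | no  a≢₁ | yes _   = ==-≢ (λ ₁≡a → a≢₁ (sym ₁≡a))
    ... | no  _   | no  _   = refl

    degree-joins : degree G a ≡ ∑[ v < V G ] ∑[ h < E G ] select (joins v h) 1
    degree-joins = begin
      degree G a
        ≡⟨ incSum-∑ G _ a ⟩
      ∑[ h < E G ] select (incident G a h) 1
        ≡⟨ sum-cong-≗ (λ h → cong (select (incident G a h)) (sym (∑-point (V G) (other h) _))) ⟩
      ∑[ h < E G ] select (incident G a h) (∑[ v < V G ] select (other h == v) 1)
        ≡⟨ sum-cong-≗ (λ h → sym (∑-select (V G) (incident G a h) _)) ⟩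
      ∑[ h < E G ] ∑[ v < V G ] select (incident G a h) (select (other h == v) 1)
        ≡⟨ sum-cong-≗ (λ h → sum-cong-≗ {V G} (λ v → sym (select-∧ (incident G a h) _ 1))) ⟩
      ∑[ h < E G ] ∑[ v < V G ] select (joins v h) 1
        ≡⟨ ∑-comm (E G) (V G) _ ⟩
      ∑[ v < V G ] ∑[ h < E G ] select (joins v h) 1 ∎
      where open ≡-Reasoning

  degree-< : degree G a < V G
  degree-< = begin-strict
    degree G a                                      ≡⟨ degree-joins ⟩
    ∑[ v < V G ] ∑[ h < E G ] select (joins v h) 1  <⟨ ∑-mono-< (V G) at-most-one a none-at-a ⟩
    ∑[ v < V G ] 1                                  ≡⟨ trans (∑-const (V G) 1) (*-identityʳ (V G)) ⟩
    V G                                             ∎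
    where
    open ≤-Reasoning
    at-most-one : ∀ v → ∑[ h < E G ] select (joins v h) 1 ≤ 1
    at-most-one v = ∑-select-unique (E G) (joins v) (joins-unique v)
    none-at-a : ∑[ h < E G ] select (joins a h) 1 < 1
    none-at-a = subst (_< 1) (sym (trans (sum-cong-≗ (λ h → cong (λ b → select b 1) (joins-self h))) (∑-zero (E G))))
                      (s≤s z≤n)

regular-degree-< : ∀ {G k} → IsSimple G → IsRegular k G → Fin (V G) → k < V G
regular-degree-< simple regular a = subst (_< _) (regular a) (degree-< simple a)

-- Injectivity from strict monotonicity

<-monotone⇒injective : ∀ {A : Set} (ρ w : A → ℕ) → Injective _≡_ _≡_ ρ →
                       (∀ {a b} → ρ a < ρ b → w a < w b) → Injective _≡_ _≡_ w
<-monotone⇒injective ρ w ρ-injective mono {a} {b} wa≡wb with <-cmp (ρ a) (ρ b)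
... | tri< ρa<ρb _ _ = ⊥-elim (<⇒≢ (mono ρa<ρb) wa≡wb)
... | tri≈ _ ρa≡ρb _ = ρ-injective ρa≡ρb
... | tri> _ _ ρb<ρa = ⊥-elim (>⇒≢ (mono ρb<ρa) wa≡wb)

lex-<-monotone⇒injective : ∀ {A B : Set} (ρ : A → ℕ) (σ : B → ℕ) (w : A → B → ℕ) →
  Injective _≡_ _≡_ ρ → Injective _≡_ _≡_ σ →
  (∀ {a a′} b b′ → ρ a < ρ a′ → w a b < w a′ b′) →
  (∀ a {b b′} → σ b < σ b′ → w a b < w a b′) →
  ∀ {a a′ b b′} → w a b ≡ w a′ b′ → a ≡ a′ × b ≡ b′
lex-<-monotone⇒injective ρ σ w ρ-injective σ-injective mono₁ mono₂ {a} {a′} {b} {b′} eq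
  with <-cmp (ρ a) (ρ a′)
... | tri< ρa<ρa′ _ _ = ⊥-elim (<⇒≢ (mono₁ b b′ ρa<ρa′) eq)
... | tri> _ _ ρa′<ρa = ⊥-elim (>⇒≢ (mono₁ b′ b ρa′<ρa) eq)
... | tri≈ _ ρa≡ρa′ _ with refl ← ρ-injective ρa≡ρa′ =
  refl , <-monotone⇒injective σ (w a) σ-injective (mono₂ a) eq

injective⇒surjective : ∀ {n} (f : Fin n → Fin n) → Injective _≡_ _≡_ f → Surjective _≡_ _≡_ f
injective⇒surjective {suc n} f f-injective y with any? (λ i → f i ≟ y)
... | yes (i , fi≡y) = i , λ { refl → fi≡y }
... | no  missed     = ⊥-elim (1+n≰n (injective⇒≤ {f = f′} f′-injective))
  where
  f′ : Fin (suc n) → Fin n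
  f′ i = punchOut {i = y} {j = f i} (λ y≡fi → missed (i , sym y≡fi))
  f′-injective : Injective _≡_ _≡_ f′
  f′-injective {i} {j} eq =
    f-injective (punchOut-injective (λ y≡fi → missed (i , sym y≡fi)) (λ y≡fj → missed (j , sym y≡fj)) eq)

-- Block encodings and ranks

module _ {w : ℕ} where

  block-<-bound : ∀ {P B r} → P < B → r < w → P * w + r < B * w
  block-<-bound {P} {B} {r} P<B r<w = begin-strict
    P * w + r  <⟨ +-monoʳ-< (P * w) r<w ⟩
    P * w + w  ≡⟨ +-comm (P * w) w ⟩
    suc P * w  ≤⟨ *-monoˡ-≤ w P<B ⟩
    B * w      ∎
    where open ≤-Reasoning

  block-< : ∀ {P P′ r r′} → P < P′ → r < w → P * w + r < P′ * w + r′
  block-< {r′ = r′} P<P′ r<w = <-≤-trans (block-<-bound P<P′ r<w) (m≤m+n _ r′)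

  block-injective : ∀ {P P′ r r′} → r < w → r′ < w → P * w + r ≡ P′ * w + r′ → P ≡ P′ × r ≡ r′
  block-injective {P} {P′} r<w r′<w eq with <-cmp P P′
  ... | tri< P<P′ _ _ = ⊥-elim (<⇒≢ (block-< P<P′ r<w) eq)
  ... | tri≈ _ refl _ = refl , +-cancelˡ-≡ (P * w) _ _ eq
  ... | tri> _ _ P′<P = ⊥-elim (>⇒≢ (block-< P′<P r′<w) eq)

module Rank {m : ℕ} (f : Fin m → ℕ) where

  private
    key : Fin m → ℕ
    key a = f a * m + toℕ a

    𝟙< : ℕ → ℕ → ℕ
    𝟙< u v with u <? v
    ... | yes _ = 1
    ... | no  _ = 0

  rank : Fin m → ℕ
  rank a = ∑[ b < m ] 𝟙< (key b) (key a)

  private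
    key-injective : Injective _≡_ _≡_ key
    key-injective {a} {b} eq = toℕ-injective (proj₂ (block-injective {P = f a} {f b} (toℕ<n a) (toℕ<n b) eq))

    𝟙<-mono : ∀ c {a b} → a < b → 𝟙< c a ≤ 𝟙< c b
    𝟙<-mono c {a} {b} a<b with c <? a | c <? b
    ... | yes _   | yes _   = ≤-refl
    ... | yes c<a | no  c≮b = ⊥-elim (c≮b (<-trans c<a a<b))
    ... | no  _   | _       = z≤n

    𝟙<-irrefl : ∀ a → 𝟙< a a ≡ 0
    𝟙<-irrefl a with a <? a
    ... | yes a<a = ⊥-elim (<-irrefl refl a<a)
    ... | no  _   = refl

    𝟙<-≤1 : ∀ a b → 𝟙< a b ≤ 1
    𝟙<-≤1 a b with a <? b
    ... | yes _ = ≤-refl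
    ... | no  _ = z≤n

    𝟙<-< : ∀ {a b} → a < b → 𝟙< a b ≡ 1
    𝟙<-< {a} {b} a<b with a <? b
    ... | yes _   = refl
    ... | no  a≮b = ⊥-elim (a≮b a<b)

    rank-<-mono : ∀ {a b} → key a < key b → rank a < rank b
    rank-<-mono {a} {b} ka<kb = ∑-mono-< m (λ c → 𝟙<-mono (key c) ka<kb) a
      (subst₂ _<_ (sym (𝟙<-irrefl (key a))) (sym (𝟙<-< ka<kb)) (s≤s z≤n))

  rank-< : ∀ a → rank a < m
  rank-< a = subst (rank a <_) (trans (∑-const m 1) (*-identityʳ m))
    (∑-mono-< m (λ b → 𝟙<-≤1 (key b) (key a)) a (subst (_< 1) (sym (𝟙<-irrefl (key a))) (s≤s z≤n)))

  rank-injective : Injective _≡_ _≡_ rank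
  rank-injective = <-monotone⇒injective key rank key-injective rank-<-mono

  rank-monotone : ∀ {a b} → rank a < rank b → f a ≤ f b
  rank-monotone {a} {b} ra<rb = ≮⇒≥ (λ fb<fa → <-asym ra<rb (rank-<-mono (block-< fb<fa (toℕ<n b))))

module Corona (G H : Graph) where

  G⋄H : Graph
  G⋄H = edgeCorona G H

  data Vertex : Set where
    base : Fin (V G) → Vertex
    copy : Fin (E G) → Fin (V H) → Vertex

  data Edge : Set where
    baseEdge       : Fin (E G) → Edge
    copyEdge       : Fin (E G) → Fin (E H) → Edge
    spoke₁ spoke₂  : Fin (E G) → Fin (V H) → Edge

  vertex : Vertex → Fin (V G⋄H)
  vertex (base v)   = v ↑ˡ (E G * V H)
  vertex (copy i a) = V G ↑ʳ combine i a

  edge : Edge → Fin (E G⋄H)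
  edge (baseEdge i)   = i ↑ˡ (E G * (E H + (V H + V H)))
  edge (copyEdge i h) = E G ↑ʳ combine i (h ↑ˡ (V H + V H))
  edge (spoke₁ i a)   = E G ↑ʳ combine i (E H ↑ʳ (a ↑ˡ V H))
  edge (spoke₂ i a)   = E G ↑ʳ combine i (E H ↑ʳ (V H ↑ʳ a))

  endpoints : Edge → Vertex × Vertex
  endpoints (baseEdge i)   = base (proj₁ (ends G i)) , base (proj₂ (ends G i))
  endpoints (copyEdge i h) = copy i (proj₁ (ends H h)) , copy i (proj₂ (ends H h))
  endpoints (spoke₁ i a)   = base (proj₁ (ends G i)) , copy i a
  endpoints (spoke₂ i a)   = base (proj₂ (ends G i)) , copy i a

  private
    decodeCopyPart : Fin (E G) × Fin (E H + (V H + V H)) → Edge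
    decodeCopyPart (i , r) = [ copyEdge i , [ spoke₁ i , spoke₂ i ]′ ∘ splitAt (V H) ]′ (splitAt (E H) r)

  decodeEdge : Fin (E G⋄H) → Edge
  decodeEdge e = [ baseEdge , decodeCopyPart ∘ remQuot (E H + (V H + V H)) ]′ (splitAt (E G) e)

  private
    quotRem-combine : ∀ {m n} (i : Fin m) (j : Fin n) → quotRem n (combine i j) ≡ (j , i)
    quotRem-combine i j = cong Product.swap (remQuot-combine i j)

  decodeEdge-edge : ∀ c → decodeEdge (edge c) ≡ c
  decodeEdge-edge (baseEdge i)   rewrite splitAt-↑ˡ (E G) i (E G * (E H + (V H + V H))) = refl
  decodeEdge-edge (copyEdge i h) rewrite splitAt-↑ʳ (E G) (E G * (E H + (V H + V H))) (combine i (h ↑ˡ (V H + V H)))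
                                       | quotRem-combine i (h ↑ˡ (V H + V H))
                                       | splitAt-↑ˡ (E H) h (V H + V H) = refl
  decodeEdge-edge (spoke₁ i a)   rewrite splitAt-↑ʳ (E G) (E G * (E H + (V H + V H))) (combine i (E H ↑ʳ (a ↑ˡ V H)))
                                       | quotRem-combine i (E H ↑ʳ (a ↑ˡ V H))
                                       | splitAt-↑ʳ (E H) (V H + V H) (a ↑ˡ V H)
                                       | splitAt-↑ˡ (V H) a (V H) = refl
  decodeEdge-edge (spoke₂ i a)   rewrite splitAt-↑ʳ (E G) (E G * (E H + (V H + V H))) (combine i (E H ↑ʳ (V H ↑ʳ a)))
                                       | quotRem-combine i (E H ↑ʳ (V H ↑ʳ a))
                                       | splitAt-↑ʳ (E H) (V H + V H) (V H ↑ʳ a)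
                                       | splitAt-↑ʳ (V H) (V H) a = refl

  private
    edge-decodeCopyPart : ∀ p → edge (decodeCopyPart p) ≡ E G ↑ʳ uncurry combine p
    edge-decodeCopyPart (i , r) with splitAt (E H) r in eq
    ... | inj₁ h = cong (λ r → E G ↑ʳ combine i r) (splitAt⁻¹-↑ˡ eq)
    ... | inj₂ s with splitAt (V H) s in eq′
    ... | inj₁ a = cong (λ r → E G ↑ʳ combine i r)
                        (trans (cong (E H ↑ʳ_) (splitAt⁻¹-↑ˡ eq′)) (splitAt⁻¹-↑ʳ eq))
    ... | inj₂ a = cong (λ r → E G ↑ʳ combine i r)
                        (trans (cong (E H ↑ʳ_) (splitAt⁻¹-↑ʳ eq′)) (splitAt⁻¹-↑ʳ eq))

  edge-decodeEdge : ∀ e → edge (decodeEdge e) ≡ e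
  edge-decodeEdge e with splitAt (E G) e in eq
  ... | inj₁ i = splitAt⁻¹-↑ˡ eq
  ... | inj₂ t = begin
    edge (decodeCopyPart (remQuot R t))        ≡⟨ edge-decodeCopyPart (remQuot {E G} R t) ⟩
    E G ↑ʳ uncurry combine (remQuot {E G} R t) ≡⟨ cong (E G ↑ʳ_) (combine-remQuot {E G} R t) ⟩
    E G ↑ʳ t                                   ≡⟨ splitAt⁻¹-↑ʳ eq ⟩
    e                                          ∎
    where
    open ≡-Reasoning
    R = E H + (V H + V H)

  vertex-surjective : ∀ u → ∃ λ w → vertex w ≡ u
  vertex-surjective u with splitAt (V G) u in eq
  ... | inj₁ v = base v , splitAt⁻¹-↑ˡ eq
  ... | inj₂ c = copy (proj₁ (remQuot {E G} (V H) c)) (proj₂ (remQuot {E G} (V H) c))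
               , trans (cong (V G ↑ʳ_) (combine-remQuot {E G} (V H) c)) (splitAt⁻¹-↑ʳ eq)

  ends-edge : ∀ c → ends G⋄H (edge c) ≡ Product.map vertex vertex (endpoints c)
  ends-edge (baseEdge i)   rewrite splitAt-↑ˡ (E G) i (E G * (E H + (V H + V H))) = refl
  ends-edge (copyEdge i h) rewrite splitAt-↑ʳ (E G) (E G * (E H + (V H + V H))) (combine i (h ↑ˡ (V H + V H)))
                                 | quotRem-combine i (h ↑ˡ (V H + V H))
                                 | splitAt-↑ˡ (E H) h (V H + V H) = refl
  ends-edge (spoke₁ i a)   rewrite splitAt-↑ʳ (E G) (E G * (E H + (V H + V H))) (combine i (E H ↑ʳ (a ↑ˡ V H)))
                                 | quotRem-combine i (E H ↑ʳ (a ↑ˡ V H))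
                                 | splitAt-↑ʳ (E H) (V H + V H) (a ↑ˡ V H)
                                 | splitAt-↑ˡ (V H) a (V H) = refl
  ends-edge (spoke₂ i a)   rewrite splitAt-↑ʳ (E G) (E G * (E H + (V H + V H))) (combine i (E H ↑ʳ (V H ↑ʳ a)))
                                 | quotRem-combine i (E H ↑ʳ (V H ↑ʳ a))
                                 | splitAt-↑ʳ (E H) (V H + V H) (V H ↑ʳ a)
                                 | splitAt-↑ʳ (V H) (V H) a = refl

  _≐_ : Vertex → Vertex → Bool
  base v   ≐ base w   = v == w
  copy i a ≐ copy j b = (i == j) ∧ (a == b)
  base _   ≐ copy _ _ = false
  copy _ _ ≐ base _   = false

  _∈ₑ_ : Vertex → Edge → Bool
  u ∈ₑ c = (u ≐ proj₁ (endpoints c)) ∨ (u ≐ proj₂ (endpoints c))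

  private
    ↑ˡ≢↑ʳ : ∀ {m n} (i : Fin m) (j : Fin n) → i ↑ˡ n ≢ m ↑ʳ j
    ↑ˡ≢↑ʳ {m} {n} i j eq = <⇒≢ (begin-strict
      toℕ (i ↑ˡ n) ≡⟨ toℕ-↑ˡ i n ⟩
      toℕ i        <⟨ toℕ<n i ⟩
      m            ≤⟨ m≤m+n m (toℕ j) ⟩
      m + toℕ j    ≡⟨ toℕ-↑ʳ m j ⟨
      toℕ (m ↑ʳ j) ∎) (cong toℕ eq)
      where open ≤-Reasoning

    combine-== : ∀ {m n} (i j : Fin m) (a b : Fin n) → (combine i a == combine j b) ≡ ((i == j) ∧ (a == b))
    combine-== i j a b with i ≟ j | a ≟ b
    ... | yes refl | yes refl = ==-refl (combine i a)
    ... | yes refl | no  a≢b  = ==-≢ (a≢b ∘ proj₂ ∘ combine-injective i a j b)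
    ... | no  i≢j  | _        = ==-≢ (i≢j ∘ proj₁ ∘ combine-injective i a j b)

  vertex-== : ∀ u w → (vertex u == vertex w) ≡ (u ≐ w)
  vertex-== (base v)   (base w)   = ==-injective (↑ˡ-injective (E G * V H) _ _) v w
  vertex-== (copy i a) (copy j b) =
    trans (==-injective (↑ʳ-injective (V G) _ _) (combine i a) (combine j b)) (combine-== i j a b)
  vertex-== (base v)   (copy j b) = ==-≢ (↑ˡ≢↑ʳ v (combine j b))
  vertex-== (copy i a) (base w)   = ==-≢ (↑ˡ≢↑ʳ w (combine i a) ∘ sym)

  incident-edge : ∀ u c → incident G⋄H (vertex u) (edge c) ≡ (u ∈ₑ c)
  incident-edge u c rewrite ends-edge c =
    cong₂ _∨_ (vertex-== u (proj₁ (endpoints c))) (vertex-== u (proj₂ (endpoints c)))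

  edgeSum : (Edge → ℕ) → ℕ
  edgeSum w = ∑[ i < E G ] w (baseEdge i)
            + ∑[ i < E G ] (∑[ h < E H ] w (copyEdge i h)
                            + (∑[ a < V H ] w (spoke₁ i a) + ∑[ a < V H ] w (spoke₂ i a)))

  ∑-edge : ∀ (f : Fin (E G⋄H) → ℕ) (w : Edge → ℕ) → (∀ c → f (edge c) ≡ w c) →
           ∑[ e < E G⋄H ] f e ≡ edgeSum w
  ∑-edge f w f∘edge≗w =
    trans (∑-↑ (E G) _ f) (cong₂ _+_ (sum-cong-≗ (f∘edge≗w ∘ baseEdge))
      (trans (∑-combine (E G) _ _) (sum-cong-≗ λ i →
        trans (∑-↑ (E H) _ _) (cong₂ _+_ (sum-cong-≗ (f∘edge≗w ∘ copyEdge i))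
          (trans (∑-↑ (V H) (V H) _) (cong₂ _+_ (sum-cong-≗ (f∘edge≗w ∘ spoke₁ i))
                                                (sum-cong-≗ (f∘edge≗w ∘ spoke₂ i))))))))

  incSum-vertex : ∀ g u → incSum G⋄H g (vertex u) ≡ edgeSum (λ c → select (u ∈ₑ c) (g (edge c)))
  incSum-vertex g u = trans (incSum-∑ G⋄H g (vertex u))
    (∑-edge _ _ (λ c → cong (λ β → select β (g (edge c))) (incident-edge u c)))

  incSum-copy : ∀ g j b → incSum G⋄H g (vertex (copy j b))
                        ≡ incSum H (g ∘ edge ∘ copyEdge j) b + (g (edge (spoke₁ j b)) + g (edge (spoke₂ j b)))
  incSum-copy g j b = begin
    incSum G⋄H g (vertex (copy j b))
      ≡⟨ incSum-vertex g (copy j b) ⟩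
    ∑[ i < E G ] 0 + ∑[ i < E G ] (∑[ h < E H ] select (copy j b ∈ₑ copyEdge i h) (g (edge (copyEdge i h)))
                                   + (∑[ a < V H ] select ((j == i) ∧ (b == a)) (g (edge (spoke₁ i a)))
                                      + ∑[ a < V H ] select ((j == i) ∧ (b == a)) (g (edge (spoke₂ i a)))))
      ≡⟨ cong₂ _+_ (∑-zero (E G)) (sum-cong-≗ copy-part) ⟩
    0 + ∑[ i < E G ] select (j == i) (Φ i)
      ≡⟨ ∑-point (E G) j Φ ⟩
    Φ j
      ≡⟨ cong₂ _+_ (sym (incSum-∑ H _ b)) (cong₂ _+_ (∑-point (V H) b _) (∑-point (V H) b _)) ⟩
    incSum H (g ∘ edge ∘ copyEdge j) b + (g (edge (spoke₁ j b)) + g (edge (spoke₂ j b))) ∎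
    where
    open ≡-Reasoning
    Φᶜ Φ₁ Φ₂ Φ : Fin (E G) → ℕ
    Φᶜ i = ∑[ h < E H ] select (incident H b h) (g (edge (copyEdge i h)))
    Φ₁ i = ∑[ a < V H ] select (b == a) (g (edge (spoke₁ i a)))
    Φ₂ i = ∑[ a < V H ] select (b == a) (g (edge (spoke₂ i a)))
    Φ  i = Φᶜ i + (Φ₁ i + Φ₂ i)
    copy-part : ∀ i → ∑[ h < E H ] select (copy j b ∈ₑ copyEdge i h) (g (edge (copyEdge i h)))
                      + (∑[ a < V H ] select ((j == i) ∧ (b == a)) (g (edge (spoke₁ i a)))
                         + ∑[ a < V H ] select ((j == i) ∧ (b == a)) (g (edge (spoke₂ i a))))
                      ≡ select (j == i) (Φ i)
    copy-part i = begin
      _ ≡⟨ cong₂ _+_ (trans (sum-cong-≗ in-copy) (∑-select-∧ (E H) (j == i) (incident H b) _))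
                     (cong₂ _+_ (∑-select-∧ (V H) (j == i) (b ==_) _) (∑-select-∧ (V H) (j == i) (b ==_) _)) ⟩
      select (j == i) (Φᶜ i) + (select (j == i) (Φ₁ i) + select (j == i) (Φ₂ i))
        ≡⟨ cong (select (j == i) (Φᶜ i) +_) (sym (select-+ (j == i) (Φ₁ i) (Φ₂ i))) ⟩
      select (j == i) (Φᶜ i) + select (j == i) (Φ₁ i + Φ₂ i)
        ≡⟨ sym (select-+ (j == i) (Φᶜ i) _) ⟩
      select (j == i) (Φ i) ∎
      where
      in-copy : ∀ h → select (copy j b ∈ₑ copyEdge i h) (g (edge (copyEdge i h)))
                    ≡ select ((j == i) ∧ incident H b h) (g (edge (copyEdge i h)))
      in-copy h = cong (λ β → select β (g (edge (copyEdge i h))))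
                       (sym (∧-distribˡ-∨ (j == i) (b == proj₁ (ends H h)) (b == proj₂ (ends H h))))

  incSum-base : ∀ g v → incSum G⋄H g (vertex (base v))
                      ≡ endSum G (g ∘ edge ∘ baseEdge) (λ i → ∑[ a < V H ] g (edge (spoke₁ i a)))
                                                       (λ i → ∑[ a < V H ] g (edge (spoke₂ i a))) v
  incSum-base g v = trans (incSum-vertex g (base v))
    (trans (cong (∑[ i < E G ] select (incident G v i) (g (edge (baseEdge i))) +_) (sum-cong-≗ spoke-part))
           (sym (∑-distrib-+ (E G) _ _)))
    where
    at-end : ∀ {n} (c : Bool) (f : Fin n → ℕ) → ∑[ a < n ] select (c ∨ false) (f a) ≡ select c (∑[ a < n ] f a)
    at-end {n} c f = trans (sum-cong-≗ (λ a → cong (λ β → select β (f a)) (∨-identityʳ c))) (∑-select n c f)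
    spoke-part : ∀ i → ∑[ h < E H ] 0 + (∑[ a < V H ] select ((v == proj₁ (ends G i)) ∨ false) (g (edge (spoke₁ i a)))
                                        + ∑[ a < V H ] select ((v == proj₂ (ends G i)) ∨ false) (g (edge (spoke₂ i a))))
                     ≡ select (v == proj₁ (ends G i)) (∑[ a < V H ] g (edge (spoke₁ i a)))
                       + select (v == proj₂ (ends G i)) (∑[ a < V H ] g (edge (spoke₂ i a)))
    spoke-part i = cong₂ _+_ (∑-zero (E H))
      (cong₂ _+_ (at-end (v == proj₁ (ends G i)) (g ∘ edge ∘ spoke₁ i))
                 (at-end (v == proj₂ (ends G i)) (g ∘ edge ∘ spoke₂ i)))

module Bistar (x n : ℕ) where

  centreOf : Fin (x + n) → Fin (2 + (x + n))
  centreOf j = [ (λ _ → zero) , (λ _ → suc zero) ]′ (splitAt x j)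

  ends-leafEdge : ∀ j → ends (bistar x n) (suc j) ≡ (centreOf j , suc (suc j))
  ends-leafEdge j with splitAt x j in eq
  ... | inj₁ a = cong (λ k → zero , suc (suc k)) (splitAt⁻¹-↑ˡ eq)
  ... | inj₂ b = cong (λ k → suc zero , suc (suc k)) (splitAt⁻¹-↑ʳ eq)

  ends-leafEdge₀ : ∀ a → ends (bistar x n) (suc (a ↑ˡ n)) ≡ (zero , suc (suc (a ↑ˡ n)))
  ends-leafEdge₀ a rewrite splitAt-↑ˡ x a n = refl

  ends-leafEdge₁ : ∀ b → ends (bistar x n) (suc (x ↑ʳ b)) ≡ (suc zero , suc (suc (x ↑ʳ b)))
  ends-leafEdge₁ b rewrite splitAt-↑ʳ x n b = refl

  leaf≢centreOf : ∀ l j → (suc (suc l) == centreOf j) ≡ false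
  leaf≢centreOf l j with splitAt x j
  ... | inj₁ _ = refl
  ... | inj₂ _ = refl

  module EndSums (B A₁ A₂ : Fin (suc (x + n)) → ℕ) where

    private
      term : Fin (2 + (x + n)) → Fin (suc (x + n)) → ℕ
      term v i = select (incident (bistar x n) v i) (B i)
                 + (select (v == proj₁ (ends (bistar x n) i)) (A₁ i)
                    + select (v == proj₂ (ends (bistar x n) i)) (A₂ i))

      term-leaf : ∀ l j → term (suc (suc l)) (suc j) ≡ select (l == j) (B (suc j) + A₂ (suc j))
      term-leaf l j rewrite ends-leafEdge j | leaf≢centreOf l j = sym (select-+ (l == j) _ _)

      term-centre₀-leafEdge₀ : ∀ a → term zero (suc (a ↑ˡ n)) ≡ B (suc (a ↑ˡ n)) + A₁ (suc (a ↑ˡ n))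
      term-centre₀-leafEdge₀ a rewrite ends-leafEdge₀ a = cong (B (suc (a ↑ˡ n)) +_) (+-identityʳ _)

      term-centre₀-leafEdge₁ : ∀ b → term zero (suc (x ↑ʳ b)) ≡ 0
      term-centre₀-leafEdge₁ b rewrite ends-leafEdge₁ b = refl

      term-centre₁-leafEdge₁ : ∀ b → term (suc zero) (suc (x ↑ʳ b)) ≡ B (suc (x ↑ʳ b)) + A₁ (suc (x ↑ʳ b))
      term-centre₁-leafEdge₁ b rewrite ends-leafEdge₁ b = cong (B (suc (x ↑ʳ b)) +_) (+-identityʳ _)

      term-centre₁-leafEdge₀ : ∀ a → term (suc zero) (suc (a ↑ˡ n)) ≡ 0
      term-centre₁-leafEdge₀ a rewrite ends-leafEdge₀ a = refl

    endSum-leaf : ∀ l → endSum (bistar x n) B A₁ A₂ (suc (suc l)) ≡ B (suc l) + A₂ (suc l)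
    endSum-leaf l = trans (sum-cong-≗ (term-leaf l)) (∑-point (x + n) l _)

    endSum-centre₀ : endSum (bistar x n) B A₁ A₂ zero
                   ≡ (B zero + A₁ zero) + ∑[ a < x ] (B (suc (a ↑ˡ n)) + A₁ (suc (a ↑ˡ n)))
    endSum-centre₀ = cong₂ _+_ (cong (B zero +_) (+-identityʳ (A₁ zero)))
      (trans (∑-↑ x n (term zero ∘ suc))
        (trans (cong₂ _+_ (sum-cong-≗ term-centre₀-leafEdge₀)
                          (trans (sum-cong-≗ term-centre₀-leafEdge₁) (∑-zero n)))
               (+-identityʳ _)))

    endSum-centre₁ : endSum (bistar x n) B A₁ A₂ (suc zero)
                   ≡ (B zero + A₂ zero) + ∑[ b < n ] (B (suc (x ↑ʳ b)) + A₁ (suc (x ↑ʳ b)))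
    endSum-centre₁ = cong (B zero + A₂ zero +_)
      (trans (∑-↑ x n (term (suc zero) ∘ suc))
        (cong₂ _+_ (trans (sum-cong-≗ term-centre₁-leafEdge₀) (∑-zero x)) (sum-cong-≗ term-centre₁-leafEdge₁)))

module Labelling (x n : ℕ) (H : Graph) where
  open Corona (bistar x n) H

  p t m : ℕ
  p = suc (x + n)
  t = E H
  m = V H

  leafPosition : Fin x ⊎ Fin n → ℕ
  leafPosition (inj₁ a) = n + toℕ a
  leafPosition (inj₂ b) = toℕ b

  position : Fin p → ℕ
  position zero    = x + n
  position (suc j) = leafPosition (splitAt x j)

  -- Spoke blocks: the first-end spokes of the leaf edges come first, then all second-end spokes, and
  -- the first-end spokes of the centre edge last, which makes the centre of the larger star heaviest.
  slot₁ slot₂ : Fin p → ℕ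
  slot₁ zero    = x + n + p
  slot₁ (suc j) = position (suc j)
  slot₂ i       = x + n + position i

  -- An edge h of copy j weighs position j * t + suc h, so a vertex b of that copy collects
  -- position j * t * degree H b + τ b from its copy of H.
  τ : Fin m → ℕ
  τ = incSum H (λ h → suc (toℕ h))

  open Rank τ public

  -- Labels run through 0 … q - 1 (an edge weighs its label + 1): copies of H in [0, p t), spoke block s
  -- in p t + [s m, (s + 1) m), edges of B_{x,n} in [p t + 2 p m, q).
  label : Edge → ℕ
  label (copyEdge i h) = position i * t + toℕ h
  label (spoke₁ i a)   = p * t + (slot₁ i * m + rank a)
  label (spoke₂ i a)   = p * t + (slot₂ i * m + rank a)
  label (baseEdge i)   = p * t + ((p + p) * m + position i)

  private
    splitAt-injective : ∀ k {l} (i j : Fin (k + l)) → splitAt k i ≡ splitAt k j → i ≡ j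
    splitAt-injective k {l} i j eq =
      trans (sym (join-splitAt k l i)) (trans (cong (join k l) eq) (join-splitAt k l j))

  leafPosition-< : ∀ s → leafPosition s < x + n
  leafPosition-< (inj₁ a) = subst (n + toℕ a <_) (+-comm n x) (+-monoʳ-< n (toℕ<n a))
  leafPosition-< (inj₂ b) = ≤-trans (toℕ<n b) (m≤n+m n x)

  leafPosition-injective : Injective _≡_ _≡_ leafPosition
  leafPosition-injective {inj₁ a} {inj₁ a′} eq = cong inj₁ (toℕ-injective (+-cancelˡ-≡ n _ _ eq))
  leafPosition-injective {inj₁ a} {inj₂ b}  eq = ⊥-elim (<⇒≱ (toℕ<n b) (subst (n ≤_) eq (m≤m+n n _)))
  leafPosition-injective {inj₂ b} {inj₁ a}  eq = ⊥-elim (<⇒≱ (toℕ<n b) (subst (n ≤_) (sym eq) (m≤m+n n _)))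
  leafPosition-injective {inj₂ b} {inj₂ b′} eq = cong inj₂ (toℕ-injective eq)

  position-leaf-< : ∀ j → position (suc j) < x + n
  position-leaf-< j = leafPosition-< (splitAt x j)

  position-< : ∀ i → position i < p
  position-< zero    = ≤-refl
  position-< (suc j) = <-trans (position-leaf-< j) ≤-refl

  position-injective : Injective _≡_ _≡_ position
  position-injective {zero}  {zero}   eq = refl
  position-injective {zero}  {suc j}  eq = ⊥-elim (<-irrefl (sym eq) (position-leaf-< j))
  position-injective {suc j} {zero}   eq = ⊥-elim (<-irrefl eq (position-leaf-< j))
  position-injective {suc j} {suc j′} eq = cong suc (splitAt-injective x j j′ (leafPosition-injective eq))

  position-leafEdge₀ : ∀ a → position (suc (a ↑ˡ n)) ≡ n + toℕ a
  position-leafEdge₀ a = cong leafPosition (splitAt-↑ˡ x a n)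

  position-leafEdge₁ : ∀ b → position (suc (x ↑ʳ b)) ≡ toℕ b
  position-leafEdge₁ b = cong leafPosition (splitAt-↑ʳ x n b)

  slot₁-<-mono : ∀ {i i′} → position i < position i′ → slot₁ i < slot₁ i′
  slot₁-<-mono {zero}  {i′}     lt = ⊥-elim (<⇒≱ lt (s≤s⁻¹ (position-< i′)))
  slot₁-<-mono {suc j} {zero}   lt = <-≤-trans (position-leaf-< j) (m≤m+n (x + n) p)
  slot₁-<-mono {suc j} {suc j′} lt = lt

  slot₂-<-mono : ∀ {i i′} → position i < position i′ → slot₂ i < slot₂ i′
  slot₂-<-mono = +-monoʳ-< (x + n)

  slot₁-< : ∀ i → slot₁ i < p + p
  slot₁-< zero    = +-monoˡ-< p ≤-refl
  slot₁-< (suc j) = <-≤-trans (position-< (suc j)) (m≤m+n p p)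

  slot₂-< : ∀ i → slot₂ i < x + n + p
  slot₂-< i = +-monoʳ-< (x + n) (position-< i)

  slot₁≢slot₂ : ∀ i i′ → slot₁ i ≢ slot₂ i′
  slot₁≢slot₂ zero    i′ eq = <-irrefl (sym eq) (slot₂-< i′)
  slot₁≢slot₂ (suc j) i′ eq = <⇒≱ (position-leaf-< j) (subst (x + n ≤_) (sym eq) (m≤m+n (x + n) _))

  slot₁-injective : Injective _≡_ _≡_ slot₁
  slot₁-injective = <-monotone⇒injective position slot₁ position-injective (λ {i} {i′} → slot₁-<-mono {i} {i′})

  slot₂-injective : Injective _≡_ _≡_ slot₂
  slot₂-injective = position-injective ∘ +-cancelˡ-≡ (x + n) _ _

  label-copy-< : ∀ i h → label (copyEdge i h) < p * t
  label-copy-< i h = block-<-bound (position-< i) (toℕ<n h)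

  label-spoke₁-< : ∀ i a → label (spoke₁ i a) < p * t + (p + p) * m
  label-spoke₁-< i a = +-monoʳ-< (p * t) (block-<-bound (slot₁-< i) (rank-< a))

  label-spoke₂-< : ∀ i a → label (spoke₂ i a) < p * t + (x + n + p) * m
  label-spoke₂-< i a = +-monoʳ-< (p * t) (block-<-bound (slot₂-< i) (rank-< a))

  label-spoke₂-≥ : ∀ i a → p * t + (x + n) * m ≤ label (spoke₂ i a)
  label-spoke₂-≥ i a = +-monoʳ-≤ (p * t) (≤-trans (*-monoˡ-≤ m (m≤m+n (x + n) _)) (m≤m+n _ (rank a)))

  label-spoke₂-<-base : ∀ i a → label (spoke₂ i a) < p * t + (p + p) * m
  label-spoke₂-<-base i a =
    <-≤-trans (label-spoke₂-< i a) (+-monoʳ-≤ (p * t) (*-monoˡ-≤ m (+-monoˡ-≤ p (n≤1+n (x + n)))))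

  label-base-≥ : ∀ i → p * t + (p + p) * m ≤ label (baseEdge i)
  label-base-≥ i = +-monoʳ-≤ (p * t) (m≤m+n _ (position i))

  label-< : ∀ c → label c < E (edgeCorona (bistar x n) H)
  label-< c = <-≤-trans (bound c) (≤-reflexive total)
    where
    total : p * t + (p + p) * m + p ≡ p + p * (t + (m + m))
    total = solve 3 (λ p t m → p :* t :+ (p :+ p) :* m :+ p := p :+ p :* (t :+ (m :+ m))) refl p t m
    bound : ∀ c → label c < p * t + (p + p) * m + p
    bound (copyEdge i h) = <-≤-trans (label-copy-< i h) (≤-trans (m≤m+n (p * t) _) (m≤m+n _ p))
    bound (spoke₁ i a)   = <-≤-trans (label-spoke₁-< i a) (m≤m+n _ p)
    bound (spoke₂ i a)   = <-≤-trans (label-spoke₂-<-base i a) (m≤m+n _ p)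
    bound (baseEdge i)   = subst (_< p * t + (p + p) * m + p) (+-assoc (p * t) ((p + p) * m) (position i))
                                 (+-monoʳ-< (p * t + (p + p) * m) (position-< i))

  label-injective : Injective _≡_ _≡_ label
  label-injective {copyEdge i h} {copyEdge i′ h′} eq
    with P≡P′ , h≡h′ ← block-injective {P = position i} {position i′} (toℕ<n h) (toℕ<n h′) eq
    = cong₂ copyEdge (position-injective P≡P′) (toℕ-injective h≡h′)
  label-injective {spoke₁ i a} {spoke₁ i′ a′} eq
    with s≡s′ , r≡r′ ← block-injective {P = slot₁ i} {slot₁ i′} (rank-< a) (rank-< a′)
                                         (+-cancelˡ-≡ (p * t) _ _ eq)
    = cong₂ spoke₁ (slot₁-injective s≡s′) (rank-injective r≡r′)
  label-injective {spoke₂ i a} {spoke₂ i′ a′} eq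
    with s≡s′ , r≡r′ ← block-injective {P = slot₂ i} {slot₂ i′} (rank-< a) (rank-< a′)
                                         (+-cancelˡ-≡ (p * t) _ _ eq)
    = cong₂ spoke₂ (slot₂-injective s≡s′) (rank-injective r≡r′)
  label-injective {baseEdge i} {baseEdge i′} eq =
    cong baseEdge (position-injective (+-cancelˡ-≡ ((p + p) * m) _ _ (+-cancelˡ-≡ (p * t) _ _ eq)))
  label-injective {spoke₁ i a} {spoke₂ i′ a′} eq = ⊥-elim (slot₁≢slot₂ i i′ (proj₁
    (block-injective (rank-< a) (rank-< a′) (+-cancelˡ-≡ (p * t) _ _ eq))))
  label-injective {spoke₂ i a} {spoke₁ i′ a′} eq = ⊥-elim (slot₁≢slot₂ i′ i (proj₁
    (block-injective (rank-< a′) (rank-< a) (+-cancelˡ-≡ (p * t) _ _ (sym eq)))))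
  label-injective {copyEdge i h} {spoke₁ _ _}   eq = ⊥-elim (<⇒≢ (<-≤-trans (label-copy-< i h) (m≤m+n _ _)) eq)
  label-injective {copyEdge i h} {spoke₂ _ _}   eq = ⊥-elim (<⇒≢ (<-≤-trans (label-copy-< i h) (m≤m+n _ _)) eq)
  label-injective {copyEdge i h} {baseEdge _}   eq = ⊥-elim (<⇒≢ (<-≤-trans (label-copy-< i h) (m≤m+n _ _)) eq)
  label-injective {spoke₁ _ _}   {copyEdge i h} eq = ⊥-elim (>⇒≢ (<-≤-trans (label-copy-< i h) (m≤m+n _ _)) eq)
  label-injective {spoke₂ _ _}   {copyEdge i h} eq = ⊥-elim (>⇒≢ (<-≤-trans (label-copy-< i h) (m≤m+n _ _)) eq)
  label-injective {baseEdge _}   {copyEdge i h} eq = ⊥-elim (>⇒≢ (<-≤-trans (label-copy-< i h) (m≤m+n _ _)) eq)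
  label-injective {spoke₁ i a}   {baseEdge i′}  eq = ⊥-elim (<⇒≢ (<-≤-trans (label-spoke₁-< i a) (label-base-≥ i′)) eq)
  label-injective {spoke₂ i a}   {baseEdge i′}  eq = ⊥-elim (<⇒≢ (<-≤-trans (label-spoke₂-<-base i a) (label-base-≥ i′)) eq)
  label-injective {baseEdge i′}  {spoke₁ i a}   eq = ⊥-elim (>⇒≢ (<-≤-trans (label-spoke₁-< i a) (label-base-≥ i′)) eq)
  label-injective {baseEdge i′}  {spoke₂ i a}   eq = ⊥-elim (>⇒≢ (<-≤-trans (label-spoke₂-<-base i a) (label-base-≥ i′)) eq)

  labelFin : Fin (E G⋄H) → Fin (E G⋄H)
  labelFin e = fromℕ< (label-< (decodeEdge e))

  labelFin-injective : Injective _≡_ _≡_ labelFin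
  labelFin-injective {e} {e′} eq = begin
    e                    ≡⟨ edge-decodeEdge e ⟨
    edge (decodeEdge e)  ≡⟨ cong edge (label-injective {decodeEdge e} {decodeEdge e′} (begin
      label (decodeEdge e)           ≡⟨ toℕ-fromℕ< (label-< (decodeEdge e)) ⟨
      toℕ (labelFin e)               ≡⟨ cong toℕ eq ⟩
      toℕ (labelFin e′)              ≡⟨ toℕ-fromℕ< (label-< (decodeEdge e′)) ⟩
      label (decodeEdge e′)          ∎)) ⟩
    edge (decodeEdge e′) ≡⟨ edge-decodeEdge e′ ⟩
    e′                   ∎
    where open ≡-Reasoning

  labelling : Fin (E G⋄H) ⤖ Fin (E G⋄H)
  labelling = mk⤖ (labelFin-injective , injective⇒surjective labelFin labelFin-injective)

  weight : Fin (E G⋄H) → ℕ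
  weight e = suc (toℕ (Bijection.to labelling e))

  weight-edge : ∀ c → weight (edge c) ≡ suc (label c)
  weight-edge c = cong suc (trans (toℕ-fromℕ< (label-< (decodeEdge (edge c)))) (cong label (decodeEdge-edge c)))

module Weights (x n : ℕ) (n≤x : n ≤ x) (H : Graph) (k : ℕ) (regular : IsRegular k H)
               (k<m : k < V H) (2≤m : 2 ≤ V H) where
  open Corona (bistar x n) H
  open Bistar x n
  open Labelling x n H

  W : Fin (V G⋄H) → ℕ
  W = incSum G⋄H weight

  copyWeight : Fin p → Fin m → ℕ
  copyWeight j b = position j * t * k + τ b + (suc (label (spoke₁ j b)) + suc (label (spoke₂ j b)))

  W-copy : ∀ j b → W (vertex (copy j b)) ≡ copyWeight j b
  W-copy j b = begin
    W (vertex (copy j b))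
      ≡⟨ incSum-copy weight j b ⟩
    incSum H (weight ∘ edge ∘ copyEdge j) b + (weight (edge (spoke₁ j b)) + weight (edge (spoke₂ j b)))
      ≡⟨ cong₂ _+_ H-part (cong₂ _+_ (weight-edge (spoke₁ j b)) (weight-edge (spoke₂ j b))) ⟩
    copyWeight j b ∎
    where
    open ≡-Reasoning
    H-part : incSum H (weight ∘ edge ∘ copyEdge j) b ≡ position j * t * k + τ b
    H-part = begin
      incSum H (weight ∘ edge ∘ copyEdge j) b
        ≡⟨ incSum-cong H (λ h → trans (weight-edge (copyEdge j h)) (sym (+-suc (position j * t) (toℕ h)))) b ⟩
      incSum H (λ h → position j * t + suc (toℕ h)) b
        ≡⟨ incSum-+-const H (position j * t) _ b ⟩
      position j * t * degree H b + τ b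
        ≡⟨ cong (λ d → position j * t * d + τ b) (regular b) ⟩
      position j * t * k + τ b ∎

  baseShare spokeShare₁ spokeShare₂ : Fin p → ℕ
  baseShare i = suc (label (baseEdge i))
  spokeShare₁ i = ∑[ a < m ] suc (label (spoke₁ i a))
  spokeShare₂ i = ∑[ a < m ] suc (label (spoke₂ i a))

  open EndSums baseShare spokeShare₁ spokeShare₂

  W-base : ∀ v → W (vertex (base v)) ≡ endSum (bistar x n) baseShare spokeShare₁ spokeShare₂ v
  W-base v = trans (incSum-base weight v)
    (endSum-cong (bistar x n) (weight-edge ∘ baseEdge) (λ i → sum-cong-≗ (weight-edge ∘ spoke₁ i))
                              (λ i → sum-cong-≗ (weight-edge ∘ spoke₂ i)) v)

  τ-≤ : ∀ b → τ b ≤ t * k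
  τ-≤ b = subst (τ b ≤_) (cong (t *_) (regular b)) (incSum-≤ H _ toℕ<n b)

  copy-H-part-≤ : ∀ j b → position j * t * k + τ b ≤ suc (position j) * t * k
  copy-H-part-≤ j b = begin
    position j * t * k + τ b      ≤⟨ +-monoʳ-≤ (position j * t * k) (τ-≤ b) ⟩
    position j * t * k + t * k    ≡⟨ *-distribʳ-+ k (position j * t) t ⟨
    (position j * t + t) * k      ≡⟨ cong (_* k) (+-comm (position j * t) t) ⟩
    suc (position j) * t * k      ∎
    where open ≤-Reasoning

  copyWeight-<-position : ∀ {j j′} b b′ → position j < position j′ → copyWeight j b < copyWeight j′ b′
  copyWeight-<-position {j} {j′} b b′ lt = +-mono-≤-< H-part (+-mono-< (s≤s spoke₁-part) (s≤s spoke₂-part))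
    where
    H-part : position j * t * k + τ b ≤ position j′ * t * k + τ b′
    H-part = ≤-trans (copy-H-part-≤ j b) (≤-trans (*-monoˡ-≤ k (*-monoˡ-≤ t lt)) (m≤m+n _ (τ b′)))
    spoke₁-part : label (spoke₁ j b) < label (spoke₁ j′ b′)
    spoke₁-part = +-monoʳ-< (p * t) (block-< (slot₁-<-mono {j} {j′} lt) (rank-< b))
    spoke₂-part : label (spoke₂ j b) < label (spoke₂ j′ b′)
    spoke₂-part = +-monoʳ-< (p * t) (block-< (slot₂-<-mono {j} {j′} lt) (rank-< b))

  copyWeight-<-rank : ∀ j {b b′} → rank b < rank b′ → copyWeight j b < copyWeight j b′
  copyWeight-<-rank j {b} {b′} lt = +-mono-≤-< (+-monoʳ-≤ (position j * t * k) (rank-monotone lt))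
    (+-mono-< (s≤s (+-monoʳ-< (p * t) (+-monoʳ-< (slot₁ j * m) lt)))
              (s≤s (+-monoʳ-< (p * t) (+-monoʳ-< (slot₂ j * m) lt))))

  copyWeight-injective : ∀ {j j′ b b′} → copyWeight j b ≡ copyWeight j′ b′ → j ≡ j′ × b ≡ b′
  copyWeight-injective = lex-<-monotone⇒injective position rank copyWeight position-injective rank-injective
    (λ {j} {j′} → copyWeight-<-position {j} {j′}) copyWeight-<-rank

  copyWeight-≤ : ∀ j b → copyWeight j b ≤ p * t * k + ((p * t + (p + p) * m) + (p * t + (x + n + p) * m))
  copyWeight-≤ j b = +-mono-≤ (≤-trans (copy-H-part-≤ j b) (*-monoˡ-≤ k (*-monoˡ-≤ t (position-< j))))
                              (+-mono-≤ (label-spoke₁-< j b) (label-spoke₂-< j b))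

  share₂ : Fin p → ℕ
  share₂ i = baseShare i + spokeShare₂ i

  baseFloor : ℕ
  baseFloor = suc (p * t + (p + p) * m) + m * suc (p * t + (x + n) * m)

  share₂-≥ : ∀ i → baseFloor ≤ share₂ i
  share₂-≥ i = +-mono-≤ (s≤s (label-base-≥ i))
    (subst (_≤ spokeShare₂ i) (∑-const m _) (∑-mono-≤ m (λ a → s≤s (label-spoke₂-≥ i a))))

  share₂-<-mono : ∀ {i i′} → position i < position i′ → share₂ i < share₂ i′
  share₂-<-mono {i} {i′} lt = +-mono-<-≤ (s≤s (+-monoʳ-< (p * t) (+-monoʳ-< ((p + p) * m) lt)))
    (∑-mono-≤ m λ a → s≤s (+-monoʳ-≤ (p * t) (+-monoˡ-≤ (rank a) (*-monoˡ-≤ m (<⇒≤ (slot₂-<-mono {i} {i′} lt))))))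

  W-leaf : ∀ l → W (vertex (base (suc (suc l)))) ≡ share₂ (suc l)
  W-leaf l = trans (W-base (suc (suc l))) (endSum-leaf l)

  share₂-≤-centre₁ : share₂ zero ≤ W (vertex (base (suc zero)))
  share₂-≤-centre₁ = subst (share₂ zero ≤_) (sym (trans (W-base (suc zero)) endSum-centre₁)) (m≤m+n _ _)

  leaf-<-centre₁ : ∀ l → W (vertex (base (suc (suc l)))) < W (vertex (base (suc zero)))
  leaf-<-centre₁ l = subst (_< W (vertex (base (suc zero)))) (sym (W-leaf l))
    (<-≤-trans (share₂-<-mono {suc l} {zero} (position-leaf-< l)) share₂-≤-centre₁)

  share₁ : Fin p → ℕ
  share₁ i = baseShare i + spokeShare₁ i

  share₁-mono : ∀ j j′ → position (suc j) ≤ position (suc j′) → share₁ (suc j) ≤ share₁ (suc j′)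
  share₁-mono j j′ le = +-mono-≤ (s≤s (+-monoʳ-≤ (p * t) (+-monoʳ-≤ ((p + p) * m) le)))
    (∑-mono-≤ m (λ a → s≤s (+-monoʳ-≤ (p * t) (+-monoˡ-≤ (rank a) (*-monoˡ-≤ m le)))))

  spokeShare₂-<-spokeShare₁-centre : spokeShare₂ zero < spokeShare₁ zero
  spokeShare₂-<-spokeShare₁-centre =
    ∑-mono-< m (λ a → <⇒≤ (spoke₂-<-spoke₁ a)) (fromℕ< {0} (≤-trans (s≤s z≤n) 2≤m)) (spoke₂-<-spoke₁ _)
    where
    spoke₂-<-spoke₁ : ∀ a → suc (label (spoke₂ zero a)) < suc (label (spoke₁ zero a))
    spoke₂-<-spoke₁ a = s≤s (+-monoʳ-< (p * t) (block-< (+-monoʳ-< (x + n) ≤-refl) (rank-< a)))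

  centre₁-<-centre₀ : W (vertex (base (suc zero))) < W (vertex (base zero))
  centre₁-<-centre₀ = begin-strict
    W (vertex (base (suc zero)))
      ≡⟨ trans (W-base (suc zero)) endSum-centre₁ ⟩
    (baseShare zero + spokeShare₂ zero) + ∑[ b < n ] share₁ (suc (x ↑ʳ b))
      <⟨ +-mono-<-≤ (+-monoʳ-< (baseShare zero) spokeShare₂-<-spokeShare₁-centre)
                    (∑-inject≤ n≤x _ _ second≤first) ⟩
    (baseShare zero + spokeShare₁ zero) + ∑[ a < x ] share₁ (suc (a ↑ˡ n))
      ≡⟨ trans (W-base zero) endSum-centre₀ ⟨
    W (vertex (base zero)) ∎
    where
    open ≤-Reasoning
    second≤first : ∀ b → share₁ (suc (x ↑ʳ b)) ≤ share₁ (suc (inject≤ b n≤x ↑ˡ n))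
    second≤first b = share₁-mono _ _ (begin
      position (suc (x ↑ʳ b))              ≡⟨ position-leafEdge₁ b ⟩
      toℕ b                                ≡⟨ toℕ-inject≤ b n≤x ⟨
      toℕ (inject≤ b n≤x)                  ≤⟨ m≤n+m _ n ⟩
      n + toℕ (inject≤ b n≤x)              ≡⟨ position-leafEdge₀ (inject≤ b n≤x) ⟨
      position (suc (inject≤ b n≤x ↑ˡ n))  ∎)

  W-base-≥ : ∀ v → baseFloor ≤ W (vertex (base v))
  W-base-≥ zero          = ≤-trans (≤-trans (share₂-≥ zero) share₂-≤-centre₁) (<⇒≤ centre₁-<-centre₀)
  W-base-≥ (suc zero)    = ≤-trans (share₂-≥ zero) share₂-≤-centre₁
  W-base-≥ (suc (suc l)) = subst (baseFloor ≤_) (sym (W-leaf l)) (share₂-≥ (suc l))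

  leaf-injective : ∀ {l l′} → W (vertex (base (suc (suc l)))) ≡ W (vertex (base (suc (suc l′)))) → l ≡ l′
  leaf-injective = <-monotone⇒injective (position ∘ suc) (λ l → W (vertex (base (suc (suc l)))))
    (suc-injective ∘ position-injective)
    (λ {l} {l′} lt → subst₂ _<_ (sym (W-leaf l)) (sym (W-leaf l′)) (share₂-<-mono {suc l} {suc l′} lt))

  base-injective : ∀ {v v′} → W (vertex (base v)) ≡ W (vertex (base v′)) → v ≡ v′
  base-injective {zero}        {zero}         eq = refl
  base-injective {suc zero}    {suc zero}     eq = refl
  base-injective {suc (suc l)} {suc (suc l′)} eq = cong (λ l → suc (suc l)) (leaf-injective eq)
  base-injective {zero}        {suc zero}     eq = ⊥-elim (>⇒≢ centre₁-<-centre₀ eq)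
  base-injective {suc zero}    {zero}         eq = ⊥-elim (<⇒≢ centre₁-<-centre₀ eq)
  base-injective {zero}        {suc (suc l)}  eq = ⊥-elim (>⇒≢ (<-trans (leaf-<-centre₁ l) centre₁-<-centre₀) eq)
  base-injective {suc (suc l)} {zero}         eq = ⊥-elim (<⇒≢ (<-trans (leaf-<-centre₁ l) centre₁-<-centre₀) eq)
  base-injective {suc zero}    {suc (suc l)}  eq = ⊥-elim (>⇒≢ (leaf-<-centre₁ l) eq)
  base-injective {suc (suc l)} {suc zero}     eq = ⊥-elim (<⇒≢ (leaf-<-centre₁ l) eq)

  copy-<-baseFloor : ∀ j b → W (vertex (copy j b)) < baseFloor
  copy-<-baseFloor j b = subst (_< baseFloor) (sym (W-copy j b))
    (≤-<-trans (copyWeight-≤ j b) (floor-gap (p * t) (x + n) k<m 2≤m))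
    where
    -- With m = 2 + m₂ and k ≤ 1 + m₂ the gap is 1 + s m m₂.
    floor-gap : ∀ e s {k m} → k < m → 2 ≤ m →
            e * k + ((e + (suc s + suc s) * m) + (e + (s + suc s) * m))
            < suc (e + (suc s + suc s) * m) + m * suc (e + s * m)
    floor-gap e s {k} {suc (suc m₂)} (s≤s k≤) _ =
      s≤s (≤-trans (+-monoˡ-≤ _ (*-monoʳ-≤ e k≤)) (≤-trans (m≤m+n _ (s * (2 + m₂) * m₂)) (≤-reflexive
        (solve 3 (λ e s m₂ → e :* (con 1 :+ m₂)
                               :+ ((e :+ (con 1 :+ s :+ (con 1 :+ s)) :* (con 2 :+ m₂))
                                   :+ (e :+ (s :+ (con 1 :+ s)) :* (con 2 :+ m₂)))
                               :+ s :* (con 2 :+ m₂) :* m₂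
                             := e :+ (con 1 :+ s :+ (con 1 :+ s)) :* (con 2 :+ m₂)
                                :+ (con 2 :+ m₂) :* (con 1 :+ e :+ s :* (con 2 :+ m₂)))
               refl e s m₂))))
    floor-gap e s {m = 1} _ (s≤s ())

  W-vertex-injective : Injective _≡_ _≡_ (W ∘ vertex)
  W-vertex-injective {base v}   {base v′}    eq = cong base (base-injective eq)
  W-vertex-injective {copy j b} {copy j′ b′} eq = uncurry (cong₂ copy)
    (copyWeight-injective {j} {j′} {b} {b′} (trans (sym (W-copy j b)) (trans eq (W-copy j′ b′))))
  W-vertex-injective {copy j b} {base v}     eq = ⊥-elim (<⇒≢ (<-≤-trans (copy-<-baseFloor j b) (W-base-≥ v)) eq)
  W-vertex-injective {base v}   {copy j b}   eq = ⊥-elim (>⇒≢ (<-≤-trans (copy-<-baseFloor j b) (W-base-≥ v)) eq)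

  W-injective : Injective _≡_ _≡_ W
  W-injective {u} {u′} eq = begin
    u                   ≡⟨ proj₂ (vertex-surjective u) ⟨
    vertex (preimage u) ≡⟨ cong vertex (W-vertex-injective {preimage u} {preimage u′} (begin
      W (vertex (preimage u))  ≡⟨ cong W (proj₂ (vertex-surjective u)) ⟩
      W u                      ≡⟨ eq ⟩
      W u′                     ≡⟨ cong W (proj₂ (vertex-surjective u′)) ⟨
      W (vertex (preimage u′)) ∎)) ⟩
    vertex (preimage u′) ≡⟨ proj₂ (vertex-surjective u′) ⟩
    u′                   ∎
    where
    open ≡-Reasoning
    preimage : Fin (V G⋄H) → Vertex
    preimage = proj₁ ∘ vertex-surjective

corollary1 : (x n : ℕ) → 2 ≤ x → 2 ≤ n → n < x →
    (H : Graph) → IsSimple H → IsConnected H →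
    (k : ℕ) → 1 ≤ k → IsRegular k H → 2 ≤ V H →
    IsAntimagic (edgeCorona (bistar x n) H)
corollary1 x n _ _ n<x H simple _ k _ regular 2≤m = labelling , W-injective
  where
  open Labelling x n H using (labelling)
  k<m : k < V H
  k<m = regular-degree-< simple regular (fromℕ< (≤-trans (s≤s z≤n) 2≤m))
  open Weights x n (<⇒≤ n<x) H k regular k<m 2≤m using (W-injective)
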